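{- Let $0<\varepsilon\le\frac14$ and consider any execution of Algorithm B (described in the context). For each edge $e\in E$, $w'_e\ge\frac{1}{4\varepsilon}\sum_{e'\in\mathcal{D}(e)}w'_{e'}$.
   Context: $G=(V,E,w)$ is a simple graph with positive edge weights, whose edges arrive in a stream in arbitrary order. Algorithm B with parameter $\varepsilon>0$ and $\beta=\frac{3\log_2(1/\varepsilon)}{\varepsilon}+1$: initialize an empty stack $S$, an empty queue $Q(v)$ and $\phi_v=0$ for every vertex $v$. For each edge $e=\{u,v\}$ in stream order: if $w_e<(1+\varepsilon)(\phi_u+\phi_v)$, skip $e$; otherwise set $w'_e=w_e-(\phi_u+\phi_v)$, then $\phi_u\leftarrow\phi_u+w'_e$, $\phi_v\leftarrow\phi_v+w'_e$, push $e$ onto $S$, and for each $x\in\{u,v\}$: enqueue $e$ into $Q(x)$, and if $|Q(x)|>\beta$, dequeue the earliest edge $e'$ from $Q(x)$ and remove $e'$ from $S$ (in this case we say $e$ evicted $e'$). After the stream, edges are popped from $S$ and greedily added to a matching. For edges never pushed to $S$, set $w'_e=0$. An edge inserted into $S$ is discarded if it is later removed from $S$ by an eviction, and kept otherwise. A discarded edge $e'$ is discarded by a kept edge $e$ if there is a sequence $e'=e_0,e_1,\dots,e_k=e$ ($k\ge1$) in which each $e_{i-1}$ was evicted by $e_i$. $\mathcal{D}(e)$ is the set of edges discarded by $e$ (empty if $e$ is not a kept edge).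
   Formalization: The parameter ε and the edge weights take rational values. -}

module Defs where

open import Data.Bool.Base using (Bool; true; false; if_then_else_; not; _∨_)
open import Data.Nat.Base as ℕ using (ℕ; zero; suc)
open import Data.Integer.Base as ℤ using (+_)
open import Data.Fin.Base using (Fin)
open import Data.Fin.Properties using (_≟_)
open import Data.Vec.Base using (Vec; lookup)
open import Data.List.Base using (List; []; _∷_; _++_; length; filter; allFin; foldl; map; sum)
open import Data.Product.Base using (_×_; _,_; proj₁; proj₂)
open import Relation.Nullary.Decidable.Core using (does; ¬?)
open import Relation.Binary.PropositionalEquality using (_≡_; _≢_)
open import Relation.Binary.Construct.Closure.Transitive using (TransClosure)
open import Data.List.Membership.Propositional using (_∈_)
open import Relation.Nullary.Negation.Core using (¬_)
open import Data.Rational.Base as ℚ using (ℚ; 0ℚ; 1ℚ; _≤ᵇ_; ↥_; ↧ₙ_)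

ℕ→ℚ : ℕ → ℚ
ℕ→ℚ k = (+ k) ℚ./ 1

_^ℚ_ : ℚ → ℕ → ℚ
q ^ℚ zero  = 1ℚ
q ^ℚ suc k = q ℚ.* (q ^ℚ k)

-- An edge of the stream: (u , v , w_e).  Edges are identified by their
-- position in the stream (an index in Fin m).
Edge : ℕ → Set
Edge n = Fin n × Fin n × ℚ

src : ∀ {n} → Edge n → Fin n
src = proj₁

tgt : ∀ {n} → Edge n → Fin n
tgt e = proj₁ (proj₂ e)

wt : ∀ {n} → Edge n → ℚ
wt e = proj₂ (proj₂ e)

-- The stream is a simple graph with positive weights, each edge arriving once:
-- no self loops, positive weights, no two positions carry the same unordered pair.
SimpleStream : ∀ {n m} → Vec (Edge n) m → Set
SimpleStream {n} {m} G =
  ((i : Fin m) → src (lookup G i) ≢ tgt (lookup G i)) ×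
  ((i : Fin m) → 0ℚ ℚ.< wt (lookup G i)) ×
  ((i j : Fin m) → i ≢ j →
     (src (lookup G i) ≡ src (lookup G j) → tgt (lookup G i) ≢ tgt (lookup G j)) ×
     (src (lookup G i) ≡ tgt (lookup G j) → tgt (lookup G i) ≢ src (lookup G j)))

-- β = 3 log₂(1/ε)/ε + 1 is in general irrational; only the test |Q(x)| > β
-- (for natural |Q(x)|) is needed.  For k = j+1 ≥ 1 and ε > 0:
--   k ≤ β  ⇔  j·ε ≤ 3 log₂(1/ε)  ⇔  2^(j·ε) ≤ ε^(-3)
--         ⇔  2^p · ε^(3q) ≤ 1   where j·ε = p/q (q > 0, p ≥ 0).
≤βᵇ : ℚ → ℕ → Bool
≤βᵇ ε zero    = true
≤βᵇ ε (suc j) =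
  let r = ℕ→ℚ j ℚ.* ε
      p = ℤ.∣ ↥ r ∣
      q = ↧ₙ r
  in (ℕ→ℚ (2 ℕ.^ p) ℚ.* (ε ^ℚ (3 ℕ.* q))) ≤ᵇ 1ℚ

>βᵇ : ℚ → ℕ → Bool
>βᵇ ε k = not (≤βᵇ ε k)

record State (n m : ℕ) : Set where
  field
    φ      : Fin n → ℚ
    w′     : Fin m → ℚ                 -- 0 for edges never pushed
    pushed : Fin m → Bool
    S      : List (Fin m)              -- the stack (head = top)
    Q      : Fin n → List (Fin m)      -- queues (head = earliest)
    evLog  : List (Fin m × Fin m)      -- (e , e′) : e evicted e′
open State public

initState : ∀ {n m} → State n m
initState = record
  { φ = λ _ → 0ℚ ; w′ = λ _ → 0ℚ ; pushed = λ _ → false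
  ; S = [] ; Q = λ _ → [] ; evLog = [] }

private
  upd : ∀ {k} {A : Set} → (Fin k → A) → Fin k → A → Fin k → A
  upd f x a y = if does (y ≟ x) then a else f y

  removeS : ∀ {m} → Fin m → List (Fin m) → List (Fin m)
  removeS e′ = filter (λ f → ¬? (f ≟ e′))

enqueue : ∀ {n m} → ℚ → Fin m → Fin n → State n m → State n m
enqueue ε i x st with Q st x ++ (i ∷ [])
... | q with >βᵇ ε (length q)
...   | false = record st { Q = upd (Q st) x q }
...   | true with q
...     | []       = record st { Q = upd (Q st) x [] }
...     | e′ ∷ q′  = record st { Q = upd (Q st) x q′
                               ; S = removeS e′ (S st)
                               ; evLog = (i , e′) ∷ evLog st }

step : ∀ {n m} → ℚ → Vec (Edge n) m → State n m → Fin m → State n m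
step ε G st i =
  let u  = src (lookup G i)
      v  = tgt (lookup G i)
      w  = wt  (lookup G i)
      s  = φ st u ℚ.+ φ st v
  in if not ((1ℚ ℚ.+ ε) ℚ.* s ≤ᵇ w)
     then st
     else
       let w'  = w ℚ.- s
           st₁ = record st
             { φ = λ y → if does (y ≟ u) ∨ does (y ≟ v) then φ st y ℚ.+ w' else φ st y
             ; w′ = upd (w′ st) i w'
             ; pushed = upd (pushed st) i true
             ; S = i ∷ S st }
       in enqueue ε i v (enqueue ε i u st₁)

run : ∀ {n m} → ℚ → Vec (Edge n) m → State n m
run {m = m} ε G = foldl (step ε G) initState (allFin m)

w′ₑ : ∀ {n m} → ℚ → Vec (Edge n) m → Fin m → ℚ
w′ₑ ε G = w′ (run ε G)

Evicts : ∀ {n m} → ℚ → Vec (Edge n) m → Fin m → Fin m → Set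
Evicts ε G e e′ = (e , e′) ∈ evLog (run ε G)

EvictedBy : ∀ {n m} → ℚ → Vec (Edge n) m → Fin m → Fin m → Set
EvictedBy ε G e′ e = Evicts ε G e e′

Kept : ∀ {n m} → ℚ → Vec (Edge n) m → Fin m → Set
Kept ε G e = (pushed (run ε G) e ≡ true) × (∀ f → ¬ Evicts ε G f e)

InD : ∀ {n m} → ℚ → Vec (Edge n) m → Fin m → Fin m → Set
InD ε G e e′ = Kept ε G e × TransClosure (EvictedBy ε G) e′ e

-- Every pushed edge e = {u, v} has w′_e ≥ ε (φ_u + φ_v) and raises both potentials by w′_e, so each
-- push multiplies the potential of an endpoint by at least 1 + ε.  Hence an edge followed by k later
-- edges in Q(x) satisfies (1 + ε)^k w′_e ≤ φ_x.  An edge is evicted from Q(x) only when |Q(x)| > β,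
-- and then (1 + ε)^(|Q(x)| - 2) ≥ ε⁻², so its weight is at most ε² φ_x ≤ ε w′ of the evicting edge.
-- Each edge evicts at most two edges (one per endpoint), all earlier in the stream, so 𝒟(e) is a
-- binary forest whose weights drop by a factor ε per level, and induction down the forest bounds
-- its total weight by 2ε (1 + 4ε) w′_e ≤ 4ε w′_e.

module Submission where

open import Defs
open import Data.Nat.Base using (ℕ)
open import Data.Fin.Base using (Fin)
open import Data.Vec.Base using (Vec)
open import Data.List.Base using (List; map; foldr)
open import Data.List.Relation.Unary.All using (All)
open import Data.List.Relation.Unary.Unique.Propositional using (Unique)
open import Data.Integer.Base using (+_)
open import Data.Rational.Base using (ℚ; 0ℚ; _+_; _*_; _/_; _<_; _≤_)

open import Algebra.Bundles using (CommutativeRing)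
open import Data.Bool.Base using (Bool; true; false; if_then_else_; _∨_; T)
open import Data.Bool.Properties using (T-≡; not-injective)
open import Data.Empty using (⊥-elim)
open import Data.Fin.Base as Fin using ()
import Data.Fin.Induction as Fin
import Data.Fin.Properties as Fin
open import Data.Fin.Properties using (_≟_)
open import Data.Integer.Base as ℤ using (-[1+_])
import Data.Integer.Properties as ℤ
import Data.Rational.Unnormalised.Base as ℚᵘ
import Data.Rational.Unnormalised.Properties as ℚᵘ
open import Data.List.Base using ([]; _∷_; _++_; [_]; length; foldl; allFin)
import Data.List.Properties as List
open import Data.List.Membership.Propositional using (_∈_)
open import Data.List.Membership.Propositional.Properties using (∈-++⁻; ∈-map⁻)
open import Data.List.Relation.Binary.Sublist.Propositional using (_⊆_; []; _∷_; _∷ʳ_)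
open import Data.List.Relation.Binary.Sublist.Propositional.Properties using (All-resp-⊆)
open import Data.List.Relation.Unary.All as All using ([]; _∷_)
import Data.List.Relation.Unary.All.Properties as All
open import Data.List.Relation.Unary.AllPairs using (AllPairs; []; _∷_)
import Data.List.Relation.Unary.AllPairs.Properties as AllPairs
open import Data.List.Relation.Unary.Any as Any using (Any)
open import Data.Nat.Base as ℕ using (zero; suc)
import Data.Nat.Properties as ℕ
open import Data.Nat.DivMod using (m≡m%n+[m/n]*n; m%n<n) renaming (_/_ to _div_; _%_ to _mod_)
open import Data.Nat.Divisibility using (∣1⇒≡1)
open import Data.Nat.Tactic.RingSolver using (solve-∀)
open import Data.Product.Base using (Σ; Σ-syntax; _×_; _,_; proj₁; proj₂)
open import Data.Rational.Base
  using (mkℚ; 1ℚ; _-_; -_; _≤ᵇ_; *≤*; *<*; ↥_; ↧ₙ_; toℚᵘ; nonNegative; Positive; positive)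
open import Data.Rational.Properties hiding (_≟_)
open import Data.Rational.Solver using (module +-*-Solver)
open import Data.Sum.Base using (_⊎_; inj₁; inj₂)
open import Data.Unit.Base using (⊤; tt)
open import Data.Vec.Base using (lookup)
open import Function.Bundles using (Equivalence)
open import Induction.WellFounded using (WellFounded; Acc; acc; module Subrelation)
open import Relation.Binary.Construct.Closure.Transitive using (TransClosure; _∷_) renaming ([_] to [_]⁺)
open import Relation.Binary.PropositionalEquality
  using (_≡_; _≢_; refl; sym; trans; cong; cong₂; cong-app; subst; subst₂; module ≡-Reasoning)
open import Relation.Nullary using (¬_; Dec; yes; no; does)

open +-*-Solver using (solve; _:+_; _:*_; _:-_; _:=_; con)
import Algebra.Properties.CommutativeSemiring.Exp
  (CommutativeRing.commutativeSemiring +-*-commutativeRing) as Exp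

0≤-* : ∀ {p q} → 0ℚ ≤ p → 0ℚ ≤ q → 0ℚ ≤ p * q
0≤-* {p} {q} 0≤p 0≤q =
  nonNegative⁻¹ _ {{nonNeg*nonNeg⇒nonNeg p {{nonNegative 0≤p}} q {{nonNegative 0≤q}}}}

*-monoˡ-≤-0≤ : ∀ {r p q} → 0ℚ ≤ r → p ≤ q → r * p ≤ r * q
*-monoˡ-≤-0≤ {r} 0≤r = *-monoˡ-≤-nonNeg r {{nonNegative 0≤r}}

*-monoʳ-≤-0≤ : ∀ {r p q} → 0ℚ ≤ r → p ≤ q → p * r ≤ q * r
*-monoʳ-≤-0≤ {r} 0≤r = *-monoʳ-≤-nonNeg r {{nonNegative 0≤r}}

*-mono-≤-0≤ : ∀ {p q r s} → 0ℚ ≤ q → 0ℚ ≤ r → p ≤ q → r ≤ s → p * r ≤ q * s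
*-mono-≤-0≤ 0≤q 0≤r p≤q r≤s = ≤-trans (*-monoʳ-≤-0≤ 0≤r p≤q) (*-monoˡ-≤-0≤ 0≤q r≤s)

p≤p+q : ∀ p {q} → 0ℚ ≤ q → p ≤ p + q
p≤p+q p {q} 0≤q = subst (_≤ p + q) (+-identityʳ p) (+-monoʳ-≤ p 0≤q)

<⇒≱ : ∀ {p q} → p < q → ¬ q ≤ p
<⇒≱ p<q q≤p = <-irrefl refl (<-≤-trans p<q q≤p)

0≤1 : 0ℚ ≤ 1ℚ
0≤1 = *≤* (ℤ.+≤+ ℕ.z≤n)

ℕ→ℚ≡mkℚ : ∀ k → ℕ→ℚ k ≡ mkℚ (+ k) 0 (λ (_ , d∣1) → ∣1⇒≡1 d∣1)
ℕ→ℚ≡mkℚ k = normalize-coprime _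

ℕ→ℚ-+ : ∀ a b → ℕ→ℚ (a ℕ.+ b) ≡ ℕ→ℚ a + ℕ→ℚ b
ℕ→ℚ-+ a b = trans (cong (_/ 1) +a+b≡) (sym (cong₂ _+_ (ℕ→ℚ≡mkℚ a) (ℕ→ℚ≡mkℚ b)))
  where
  +a+b≡ : + (a ℕ.+ b) ≡ + a ℤ.* + 1 ℤ.+ + b ℤ.* + 1
  +a+b≡ = trans (ℤ.pos-+ a b) (sym (cong₂ ℤ._+_ (ℤ.*-identityʳ (+ a)) (ℤ.*-identityʳ (+ b))))

ℕ→ℚ-* : ∀ a b → ℕ→ℚ (a ℕ.* b) ≡ ℕ→ℚ a * ℕ→ℚ b
ℕ→ℚ-* a b = trans (cong (_/ 1) (ℤ.pos-* a b)) (sym (cong₂ _*_ (ℕ→ℚ≡mkℚ a) (ℕ→ℚ≡mkℚ b)))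

ℕ→ℚ-mono-< : ∀ {a b} → a ℕ.< b → ℕ→ℚ a < ℕ→ℚ b
ℕ→ℚ-mono-< {a} {b} a<b rewrite ℕ→ℚ≡mkℚ a | ℕ→ℚ≡mkℚ b =
  *<* (subst₂ ℤ._<_ (sym (ℤ.*-identityʳ (+ a))) (sym (ℤ.*-identityʳ (+ b))) (ℤ.+<+ a<b))

ℕ→ℚ-mono-≤ : ∀ {a b} → a ℕ.≤ b → ℕ→ℚ a ≤ ℕ→ℚ b
ℕ→ℚ-mono-≤ {a} {b} a≤b rewrite ℕ→ℚ≡mkℚ a | ℕ→ℚ≡mkℚ b =
  *≤* (subst₂ ℤ._≤_ (sym (ℤ.*-identityʳ (+ a))) (sym (ℤ.*-identityʳ (+ b))) (ℤ.+≤+ a≤b))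

ℕ→ℚ-cancel-≤ : ∀ {a b} → ℕ→ℚ a ≤ ℕ→ℚ b → a ℕ.≤ b
ℕ→ℚ-cancel-≤ {a} {b} a≤b with a ℕ.≤? b
... | yes a≤ᵇb = a≤ᵇb
... | no a≰b = ⊥-elim (<⇒≱ (ℕ→ℚ-mono-< (ℕ.≰⇒> a≰b)) a≤b)

ℕ→ℚ-nonNeg : ∀ k → 0ℚ ≤ ℕ→ℚ k
ℕ→ℚ-nonNeg k = ℕ→ℚ-mono-≤ (ℕ.z≤n {k})

scale-bound : ∀ x b p c d → x * ℕ→ℚ b ≡ ℕ→ℚ p → x * ℕ→ℚ d ≤ ℕ→ℚ c → d ℕ.* p ℕ.≤ c ℕ.* b
scale-bound x b p c d xb≡p xd≤c = ℕ→ℚ-cancel-≤ (begin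
  ℕ→ℚ (d ℕ.* p)        ≡⟨ trans (ℕ→ℚ-* d p) (cong (ℕ→ℚ d *_) (sym xb≡p)) ⟩
  ℕ→ℚ d * (x * ℕ→ℚ b)  ≡⟨ solve 3 (λ d x b → d :* (x :* b) := x :* d :* b) refl (ℕ→ℚ d) x (ℕ→ℚ b) ⟩
  x * ℕ→ℚ d * ℕ→ℚ b    ≤⟨ *-monoʳ-≤-0≤ (ℕ→ℚ-nonNeg b) xd≤c ⟩
  ℕ→ℚ c * ℕ→ℚ b        ≡⟨ sym (ℕ→ℚ-* c b) ⟩
  ℕ→ℚ (c ℕ.* b)        ∎)
  where open ≤-Reasoning

^ℚ≡^ : ∀ p k → p ^ℚ k ≡ p Exp.^ k
^ℚ≡^ p zero = refl
^ℚ≡^ p (suc k) = cong (p *_) (^ℚ≡^ p k)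

^ℚ-+ : ∀ p i j → p ^ℚ (i ℕ.+ j) ≡ p ^ℚ i * p ^ℚ j
^ℚ-+ p i j rewrite ^ℚ≡^ p (i ℕ.+ j) | ^ℚ≡^ p i | ^ℚ≡^ p j = Exp.^-homo-* p i j

^ℚ-* : ∀ p i j → p ^ℚ (i ℕ.* j) ≡ (p ^ℚ i) ^ℚ j
^ℚ-* p i j rewrite ^ℚ≡^ p (i ℕ.* j) | ^ℚ≡^ p i | ^ℚ≡^ (p Exp.^ i) j = sym (Exp.^-assocʳ p i j)

^ℚ-distrib-* : ∀ p q k → (p * q) ^ℚ k ≡ p ^ℚ k * q ^ℚ k
^ℚ-distrib-* p q k rewrite ^ℚ≡^ (p * q) k | ^ℚ≡^ p k | ^ℚ≡^ q k = Exp.^-distrib-* p q k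

1^ℚ : ∀ k → 1ℚ ^ℚ k ≡ 1ℚ
1^ℚ zero = refl
1^ℚ (suc k) = trans (*-identityˡ _) (1^ℚ k)

ℕ→ℚ-^ : ∀ a k → ℕ→ℚ (a ℕ.^ k) ≡ ℕ→ℚ a ^ℚ k
ℕ→ℚ-^ a zero = refl
ℕ→ℚ-^ a (suc k) = trans (ℕ→ℚ-* a (a ℕ.^ k)) (cong (ℕ→ℚ a *_) (ℕ→ℚ-^ a k))

^ℚ-nonNeg : ∀ {p} k → 0ℚ ≤ p → 0ℚ ≤ p ^ℚ k
^ℚ-nonNeg zero _ = 0≤1
^ℚ-nonNeg (suc k) 0≤p = 0≤-* 0≤p (^ℚ-nonNeg k 0≤p)

^ℚ-monoˡ-≤ : ∀ {p q} k → 0ℚ ≤ p → p ≤ q → p ^ℚ k ≤ q ^ℚ k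
^ℚ-monoˡ-≤ zero _ _ = ≤-refl
^ℚ-monoˡ-≤ (suc k) 0≤p p≤q =
  *-mono-≤-0≤ (≤-trans 0≤p p≤q) (^ℚ-nonNeg k 0≤p) p≤q (^ℚ-monoˡ-≤ k 0≤p p≤q)

^ℚ-monoʳ-≤ : ∀ {p} → 1ℚ ≤ p → ∀ {i j} → i ℕ.≤ j → p ^ℚ i ≤ p ^ℚ j
^ℚ-monoʳ-≤ {p} 1≤p {i} i≤j with ℕ.m≤n⇒∃[o]m+o≡n i≤j
... | o , refl = begin
  p ^ℚ i           ≡⟨ sym (*-identityʳ _) ⟩
  p ^ℚ i * 1ℚ      ≤⟨ *-monoˡ-≤-0≤ (^ℚ-nonNeg i 0≤p) 1≤p^o ⟩
  p ^ℚ i * p ^ℚ o  ≡⟨ sym (^ℚ-+ p i o) ⟩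
  p ^ℚ (i ℕ.+ o)   ∎
  where
  open ≤-Reasoning
  0≤p = ≤-trans 0≤1 1≤p
  1≤p^o : 1ℚ ≤ p ^ℚ o
  1≤p^o = subst (_≤ p ^ℚ o) (1^ℚ o) (^ℚ-monoˡ-≤ o 0≤1 1≤p)

≤1⇒^ℚ≤1 : ∀ {p} k → 0ℚ ≤ p → p ≤ 1ℚ → p ^ℚ k ≤ 1ℚ
≤1⇒^ℚ≤1 {p} k 0≤p p≤1 = subst (p ^ℚ k ≤_) (1^ℚ k) (^ℚ-monoˡ-≤ k 0≤p p≤1)

^ℚ≥1⇒≥1 : ∀ {p} k .{{_ : ℕ.NonZero k}} → 0ℚ ≤ p → 1ℚ ≤ p ^ℚ k → 1ℚ ≤ p
^ℚ≥1⇒≥1 {p} (suc k) 0≤p 1≤p^k+1 with 1ℚ ≤? p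
... | yes 1≤p = 1≤p
... | no 1≰p = ⊥-elim (<⇒≱ p^k+1<1 1≤p^k+1)
  where
  open ≤-Reasoning
  p<1 = ≰⇒> 1≰p
  p^k+1<1 : p ^ℚ suc k < 1ℚ
  p^k+1<1 = begin-strict
    p * p ^ℚ k ≤⟨ *-monoˡ-≤-0≤ 0≤p (≤1⇒^ℚ≤1 k 0≤p (<⇒≤ p<1)) ⟩
    p * 1ℚ     ≡⟨ *-identityʳ p ⟩
    p          <⟨ p<1 ⟩
    1ℚ         ∎

bernoulli : ∀ {p} k → 0ℚ ≤ p → 1ℚ + ℕ→ℚ k * p ≤ (1ℚ + p) ^ℚ k
bernoulli {p} zero 0≤p = ≤-reflexive (trans (cong (λ z → 1ℚ + z) (*-zeroˡ p)) (+-identityʳ 1ℚ))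
bernoulli {p} (suc k) 0≤p = begin
  1ℚ + ℕ→ℚ (suc k) * p                          ≡⟨ cong (λ z → 1ℚ + z * p) (ℕ→ℚ-+ 1 k) ⟩
  1ℚ + (1ℚ + ℕ→ℚ k) * p                         ≡⟨ solve 2 (λ x p → con 1ℚ :+ (con 1ℚ :+ x) :* p
                                                     := con 1ℚ :+ (p :+ x :* p)) refl (ℕ→ℚ k) p ⟩
  1ℚ + (p + ℕ→ℚ k * p)                          ≤⟨ p≤p+q _ (0≤-* (0≤-* (ℕ→ℚ-nonNeg k) 0≤p) 0≤p) ⟩
  1ℚ + (p + ℕ→ℚ k * p) + ℕ→ℚ k * p * p          ≡⟨ solve 2 (λ x p → con 1ℚ :+ (p :+ x :* p) :+ x :* p :* p
                                                     := (con 1ℚ :+ p) :* (con 1ℚ :+ x :* p)) refl (ℕ→ℚ k) p ⟩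
  (1ℚ + p) * (1ℚ + ℕ→ℚ k * p)                   ≤⟨ *-monoˡ-≤-0≤ (+-mono-≤ 0≤1 0≤p) (bernoulli k 0≤p) ⟩
  (1ℚ + p) * (1ℚ + p) ^ℚ k                      ∎
  where open ≤-Reasoning

p*↧p≡↥p : ∀ p → 0ℚ ≤ p → p * ℕ→ℚ (↧ₙ p) ≡ ℕ→ℚ ℤ.∣ ↥ p ∣
p*↧p≡↥p p@(mkℚ (+ a) d _) _ = toℚᵘ-injective (ℚᵘ.≃-trans (toℚᵘ-homo-* p (ℕ→ℚ (suc d))) unnormalised)
  where
  unnormalised : toℚᵘ p ℚᵘ.* toℚᵘ (ℕ→ℚ (suc d)) ℚᵘ.≃ toℚᵘ (ℕ→ℚ a)
  unnormalised rewrite ℕ→ℚ≡mkℚ (suc d) | ℕ→ℚ≡mkℚ a =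
    ℚᵘ.*≡* (trans (ℤ.*-identityʳ _) (cong (λ z → + a ℤ.* + suc z) (sym (ℕ.*-identityʳ d))))
p*↧p≡↥p (mkℚ -[1+ _ ] _ _) (*≤* ())

multiple-between-1-and-1+p : ∀ p → 0ℚ < p → Σ ℕ λ k → 1ℚ ≤ ℕ→ℚ k * p × ℕ→ℚ k * p ≤ 1ℚ + p
multiple-between-1-and-1+p (mkℚ (+ zero) _ _) (*<* (ℤ.+<+ ()))
multiple-between-1-and-1+p p@(mkℚ (+ suc a-1) b-1 _) 0<p = k , 1≤kp , kp≤1+p
  where
  open ≤-Reasoning
  a = suc a-1
  b = suc b-1
  k = suc (b div a)
  instance
    b-pos : Positive (ℕ→ℚ b)
    b-pos = positive (ℕ→ℚ-mono-< (ℕ.s≤s (ℕ.z≤n {b-1})))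
  b≡ : b ≡ b mod a ℕ.+ (b div a) ℕ.* a
  b≡ = m≡m%n+[m/n]*n b a
  b≤ka : b ℕ.≤ k ℕ.* a
  b≤ka = ℕ.≤-trans (ℕ.≤-reflexive b≡) (ℕ.+-monoˡ-≤ ((b div a) ℕ.* a) (ℕ.<⇒≤ (m%n<n b a)))
  ka≤b+a : k ℕ.* a ℕ.≤ b ℕ.+ a
  ka≤b+a = ℕ.≤-trans (ℕ.≤-reflexive (ℕ.+-comm a _))
             (ℕ.+-monoˡ-≤ a (ℕ.≤-trans (ℕ.m≤n+m _ (b mod a)) (ℕ.≤-reflexive (sym b≡))))
  pb≡a : p * ℕ→ℚ b ≡ ℕ→ℚ a
  pb≡a = p*↧p≡↥p p (<⇒≤ 0<p)
  kpb≡ka : ℕ→ℚ k * p * ℕ→ℚ b ≡ ℕ→ℚ (k ℕ.* a)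
  kpb≡ka = trans (*-assoc (ℕ→ℚ k) p (ℕ→ℚ b)) (trans (cong (ℕ→ℚ k *_) pb≡a) (sym (ℕ→ℚ-* k a)))
  1≤kp : 1ℚ ≤ ℕ→ℚ k * p
  1≤kp = *-cancelʳ-≤-pos (ℕ→ℚ b) (begin
    1ℚ * ℕ→ℚ b          ≡⟨ *-identityˡ _ ⟩
    ℕ→ℚ b               ≤⟨ ℕ→ℚ-mono-≤ b≤ka ⟩
    ℕ→ℚ (k ℕ.* a)       ≡⟨ sym kpb≡ka ⟩
    ℕ→ℚ k * p * ℕ→ℚ b   ∎)
  kp≤1+p : ℕ→ℚ k * p ≤ 1ℚ + p
  kp≤1+p = *-cancelʳ-≤-pos (ℕ→ℚ b) (begin
    ℕ→ℚ k * p * ℕ→ℚ b   ≡⟨ kpb≡ka ⟩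
    ℕ→ℚ (k ℕ.* a)       ≤⟨ ℕ→ℚ-mono-≤ ka≤b+a ⟩
    ℕ→ℚ (b ℕ.+ a)       ≡⟨ trans (ℕ→ℚ-+ b a) (cong (λ z → ℕ→ℚ b + z) (sym pb≡a)) ⟩
    ℕ→ℚ b + p * ℕ→ℚ b   ≡⟨ solve 2 (λ b p → b :+ p :* b := (con 1ℚ :+ p) :* b) refl (ℕ→ℚ b) p ⟩
    (1ℚ + p) * ℕ→ℚ b    ∎)

-- The threshold β

module Threshold (ε : ℚ) (0<ε : 0ℚ < ε) (ε≤¼ : ε ≤ + 1 / 4) where

  open ≤-Reasoning

  1+ε : ℚ
  1+ε = 1ℚ + ε

  0≤ε : 0ℚ ≤ ε
  0≤ε = <⇒≤ 0<ε

  1≤1+ε : 1ℚ ≤ 1+ε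
  1≤1+ε = p≤p+q 1ℚ 0≤ε

  0≤1+ε : 0ℚ ≤ 1+ε
  0≤1+ε = ≤-trans 0≤1 1≤1+ε

  βterm : ℕ → ℕ → ℚ
  βterm p q = ℕ→ℚ (2 ℕ.^ p) * ε ^ℚ (3 ℕ.* q)

  1≤β : ≤βᵇ ε 1 ≡ true
  1≤β rewrite *-zeroˡ ε = Equivalence.to T-≡ (≤⇒≤ᵇ (begin
    1ℚ * ε ^ℚ 3  ≡⟨ *-identityˡ _ ⟩
    ε ^ℚ 3       ≤⟨ ≤1⇒^ℚ≤1 3 0≤ε (≤-trans ε≤¼ (*≤* (ℤ.+≤+ (ℕ.s≤s ℕ.z≤n)))) ⟩
    1ℚ           ∎))

  βterm-nonNeg : ∀ p q → 0ℚ ≤ βterm p q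
  βterm-nonNeg p q = 0≤-* (ℕ→ℚ-nonNeg (2 ℕ.^ p)) (^ℚ-nonNeg (3 ℕ.* q) 0≤ε)

  βterm≤1 : ∀ L p q → L ℕ.≤ 5 → ℕ→ℚ L * ε * ℕ→ℚ q ≡ ℕ→ℚ p → βterm p q ≤ 1ℚ
  βterm≤1 L p q L≤5 Lεq≡p = begin
    ℕ→ℚ (2 ℕ.^ p) * ε ^ℚ (3 ℕ.* q)
      ≤⟨ *-mono-≤-0≤ (ℕ→ℚ-nonNeg (2 ℕ.^ (6 ℕ.* q))) (^ℚ-nonNeg (3 ℕ.* q) 0≤ε)
           (ℕ→ℚ-mono-≤ (ℕ.^-monoʳ-≤ 2 p≤6q)) (^ℚ-monoˡ-≤ (3 ℕ.* q) 0≤ε ε≤¼) ⟩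
    ℕ→ℚ (2 ℕ.^ (6 ℕ.* q)) * (+ 1 / 4) ^ℚ (3 ℕ.* q)
      ≡⟨ cong₂ _*_ (trans (ℕ→ℚ-^ 2 (6 ℕ.* q)) (^ℚ-* (ℕ→ℚ 2) 6 q)) (^ℚ-* (+ 1 / 4) 3 q) ⟩
    (ℕ→ℚ 2 ^ℚ 6) ^ℚ q * ((+ 1 / 4) ^ℚ 3) ^ℚ q
      ≡⟨ sym (^ℚ-distrib-* (ℕ→ℚ 2 ^ℚ 6) ((+ 1 / 4) ^ℚ 3) q) ⟩
    (ℕ→ℚ 2 ^ℚ 6 * (+ 1 / 4) ^ℚ 3) ^ℚ q
      ≡⟨ 1^ℚ q ⟩
    1ℚ ∎
    where
    four-Lε≤5 : ℕ→ℚ L * ε * ℕ→ℚ 4 ≤ ℕ→ℚ 5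
    four-Lε≤5 = begin
      ℕ→ℚ L * ε * ℕ→ℚ 4         ≤⟨ *-monoʳ-≤-0≤ (ℕ→ℚ-nonNeg 4)
                                      (*-mono-≤-0≤ (ℕ→ℚ-nonNeg 5) 0≤ε (ℕ→ℚ-mono-≤ L≤5) ε≤¼) ⟩
      ℕ→ℚ 5 * (+ 1 / 4) * ℕ→ℚ 4 ≡⟨ refl ⟩
      ℕ→ℚ 5                     ∎
    4p≤24q : 4 ℕ.* p ℕ.≤ 4 ℕ.* (6 ℕ.* q)
    4p≤24q = ℕ.≤-trans (scale-bound (ℕ→ℚ L * ε) q p 5 4 Lεq≡p four-Lε≤5)
               (ℕ.≤-trans (ℕ.*-monoˡ-≤ q (ℕ.m≤m+n 5 19)) (ℕ.≤-reflexive (ℕ.*-assoc 4 6 q)))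
    p≤6q : p ℕ.≤ 6 ℕ.* q
    p≤6q = ℕ.*-cancelˡ-≤ 4 4p≤24q

  4≤[1+ε]^2k : ∀ k → 1ℚ ≤ ℕ→ℚ k * ε → ℕ→ℚ 4 ≤ 1+ε ^ℚ (k ℕ.+ k)
  4≤[1+ε]^2k k 1≤kε = begin
    (1ℚ + 1ℚ) * (1ℚ + 1ℚ)  ≤⟨ *-mono-≤-0≤ (^ℚ-nonNeg k 0≤1+ε) (+-mono-≤ 0≤1 0≤1) 2≤[1+ε]^k 2≤[1+ε]^k ⟩
    1+ε ^ℚ k * 1+ε ^ℚ k    ≡⟨ sym (^ℚ-+ 1+ε k k) ⟩
    1+ε ^ℚ (k ℕ.+ k)       ∎
    where
    2≤[1+ε]^k : 1ℚ + 1ℚ ≤ 1+ε ^ℚ k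
    2≤[1+ε]^k = ≤-trans (+-monoʳ-≤ 1ℚ 1≤kε) (bernoulli k 0≤ε)

  2kp≤3qn : ∀ n p q k → 5 ℕ.≤ n → ℕ→ℚ (suc n) * ε * ℕ→ℚ q ≡ ℕ→ℚ p → ℕ→ℚ k * ε ≤ 1+ε →
            (k ℕ.+ k) ℕ.* p ℕ.≤ n ℕ.* (3 ℕ.* q)
  2kp≤3qn n p q k 5≤n nεq≡p kε≤1+ε with ℕ.m≤n⇒∃[o]m+o≡n 5≤n
  ... | t , refl = ℕ.*-cancelˡ-≤ 2 (ℕ.≤-trans (ℕ.≤-reflexive (4kp≡ k p))
        (ℕ.≤-trans (scale-bound (ℕ→ℚ k * ε) (suc n ℕ.* q) (k ℕ.* p) 5 4 kε[n+1]q≡kp four-kε≤5)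
          (ℕ.≤-trans (ℕ.m≤m+n _ (t ℕ.* q)) (ℕ.≤-reflexive (6nq≡ t q)))))
    where
    4kp≡ : ∀ k p → 2 ℕ.* ((k ℕ.+ k) ℕ.* p) ≡ 4 ℕ.* (k ℕ.* p)
    4kp≡ = solve-∀
    6nq≡ : ∀ t q → 5 ℕ.* (suc (5 ℕ.+ t) ℕ.* q) ℕ.+ t ℕ.* q ≡ 2 ℕ.* ((5 ℕ.+ t) ℕ.* (3 ℕ.* q))
    6nq≡ = solve-∀
    four-kε≤5 : ℕ→ℚ k * ε * ℕ→ℚ 4 ≤ ℕ→ℚ 5
    four-kε≤5 = begin
      ℕ→ℚ k * ε * ℕ→ℚ 4       ≤⟨ *-monoʳ-≤-0≤ (ℕ→ℚ-nonNeg 4) (≤-trans kε≤1+ε (+-monoʳ-≤ 1ℚ ε≤¼)) ⟩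
      (1ℚ + + 1 / 4) * ℕ→ℚ 4  ≡⟨ refl ⟩
      ℕ→ℚ 5                   ∎
    kε[n+1]q≡kp : ℕ→ℚ k * ε * ℕ→ℚ (suc n ℕ.* q) ≡ ℕ→ℚ (k ℕ.* p)
    kε[n+1]q≡kp = begin-equality
      ℕ→ℚ k * ε * ℕ→ℚ (suc n ℕ.* q)       ≡⟨ cong (ℕ→ℚ k * ε *_) (ℕ→ℚ-* (suc n) q) ⟩
      ℕ→ℚ k * ε * (ℕ→ℚ (suc n) * ℕ→ℚ q)   ≡⟨ solve 4 (λ k e m q → k :* e :* (m :* q) := k :* (m :* e :* q))
                                               refl (ℕ→ℚ k) ε (ℕ→ℚ (suc n)) (ℕ→ℚ q) ⟩
      ℕ→ℚ k * (ℕ→ℚ (suc n) * ε * ℕ→ℚ q)   ≡⟨ cong (ℕ→ℚ k *_) nεq≡p ⟩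
      ℕ→ℚ k * ℕ→ℚ p                        ≡⟨ sym (ℕ→ℚ-* k p) ⟩
      ℕ→ℚ (k ℕ.* p)                        ∎

  -- Choosing k with 1 ≤ kε ≤ 1 + ε (so (1+ε)^(2k) ≥ 4 and 2kp ≤ 3qn) gives
  -- 1 < βterm² = 4^p ε^(6q) ≤ (ε²(1+ε)^n)^(3q).
  βterm>1⇒1≤ε²[1+ε]^ : ∀ n p {q} → 5 ℕ.≤ n → ℕ→ℚ (suc n) * ε * ℕ→ℚ (suc q) ≡ ℕ→ℚ p →
                       1ℚ < βterm p (suc q) → 1ℚ ≤ ε * ε * 1+ε ^ℚ n
  βterm>1⇒1≤ε²[1+ε]^ n p {q-1} 5≤n nεq≡p 1<βterm
    with multiple-between-1-and-1+p ε 0<ε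
  ... | k , 1≤kε , kε≤1+ε = ^ℚ≥1⇒≥1 j (0≤-* (0≤-* 0≤ε 0≤ε) (^ℚ-nonNeg n 0≤1+ε)) (begin
    1ℚ * 1ℚ                                  ≤⟨ *-mono-≤-0≤ (βterm-nonNeg p q) 0≤1 1≤βterm 1≤βterm ⟩
    βterm p q * βterm p q                    ≡⟨ solve 2 (λ a b → (a :* b) :* (a :* b) := (b :* b) :* (a :* a))
                                                  refl (ℕ→ℚ (2 ℕ.^ p)) (ε ^ℚ j) ⟩
    ε^j² * (ℕ→ℚ (2 ℕ.^ p) * ℕ→ℚ (2 ℕ.^ p))  ≡⟨ cong (ε^j² *_) 2^p*2^p≡4^p ⟩
    ε^j² * ℕ→ℚ 4 ^ℚ p                        ≤⟨ *-monoˡ-≤-0≤ 0≤ε^j²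
                                                  (^ℚ-monoˡ-≤ p (ℕ→ℚ-nonNeg 4) (4≤[1+ε]^2k k 1≤kε)) ⟩
    ε^j² * (1+ε ^ℚ (k ℕ.+ k)) ^ℚ p           ≡⟨ cong (ε^j² *_) (sym (^ℚ-* 1+ε (k ℕ.+ k) p)) ⟩
    ε^j² * 1+ε ^ℚ ((k ℕ.+ k) ℕ.* p)          ≤⟨ *-monoˡ-≤-0≤ 0≤ε^j²
                                                  (^ℚ-monoʳ-≤ 1≤1+ε (2kp≤3qn n p q k 5≤n nεq≡p kε≤1+ε)) ⟩
    ε^j² * 1+ε ^ℚ (n ℕ.* j)                  ≡⟨ cong₂ _*_ (sym (^ℚ-distrib-* ε ε j)) (^ℚ-* 1+ε n j) ⟩
    (ε * ε) ^ℚ j * (1+ε ^ℚ n) ^ℚ j           ≡⟨ sym (^ℚ-distrib-* (ε * ε) (1+ε ^ℚ n) j) ⟩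
    (ε * ε * 1+ε ^ℚ n) ^ℚ j                  ∎)
    where
    q = suc q-1
    j = 3 ℕ.* q
    ε^j² = ε ^ℚ j * ε ^ℚ j
    0≤ε^j² : 0ℚ ≤ ε^j²
    0≤ε^j² = 0≤-* (^ℚ-nonNeg j 0≤ε) (^ℚ-nonNeg j 0≤ε)
    1≤βterm = <⇒≤ 1<βterm
    2^p*2^p≡4^p : ℕ→ℚ (2 ℕ.^ p) * ℕ→ℚ (2 ℕ.^ p) ≡ ℕ→ℚ 4 ^ℚ p
    2^p*2^p≡4^p = trans (cong₂ _*_ (ℕ→ℚ-^ 2 p) (ℕ→ℚ-^ 2 p)) (sym (^ℚ-distrib-* (ℕ→ℚ 2) (ℕ→ℚ 2) p))

  2+l>β⇒1≤ε²[1+ε]^l : ∀ l → ≤βᵇ ε (suc (suc l)) ≡ false → 1ℚ ≤ ε * ε * 1+ε ^ℚ l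
  2+l>β⇒1≤ε²[1+ε]^l l 2+l>β = by-size (l ℕ.<? 5)
    where
    r = ℕ→ℚ (suc l) * ε
    rq≡p : r * ℕ→ℚ (↧ₙ r) ≡ ℕ→ℚ ℤ.∣ ↥ r ∣
    rq≡p = p*↧p≡↥p r (0≤-* (ℕ→ℚ-nonNeg (suc l)) 0≤ε)
    -- ≤βᵇ ε (suc (suc l)) unfolds to βterm p q ≤ᵇ 1 where r = p / q in lowest terms.
    1<βterm : 1ℚ < βterm ℤ.∣ ↥ r ∣ (↧ₙ r)
    1<βterm = ≰⇒> (λ βterm≤1 → subst T 2+l>β (≤⇒≤ᵇ βterm≤1))
    by-size : Dec (l ℕ.< 5) → 1ℚ ≤ ε * ε * 1+ε ^ℚ l
    by-size (yes l<5) = ⊥-elim (<⇒≱ 1<βterm (βterm≤1 (suc l) ℤ.∣ ↥ r ∣ (↧ₙ r) l<5 rq≡p))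
    by-size (no l≮5) = βterm>1⇒1≤ε²[1+ε]^ l ℤ.∣ ↥ r ∣ {ℚ.denominator-1 r} (ℕ.≮⇒≥ l≮5) rq≡p 1<βterm

-- Weighted sums and decaying forests

Unique-resp-⊆ : ∀ {A : Set} {xs ys : List A} → xs ⊆ ys → Unique ys → Unique xs
Unique-resp-⊆ [] [] = []
Unique-resp-⊆ (_ ∷ʳ xs⊆ys) (_ ∷ u) = Unique-resp-⊆ xs⊆ys u
Unique-resp-⊆ (refl ∷ xs⊆ys) (x∉ys ∷ u) = All-resp-⊆ xs⊆ys x∉ys ∷ Unique-resp-⊆ xs⊆ys u

TransClosure-last : ∀ {A : Set} {_∼_ : A → A → Set} {x z} → TransClosure _∼_ x z →
                    Σ[ y ∈ A ] (y ∼ z × (x ≡ y ⊎ TransClosure _∼_ x y))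
TransClosure-last [ x∼z ]⁺ = _ , x∼z , inj₁ refl
TransClosure-last (x∼y ∷ y∼⁺z) with TransClosure-last y∼⁺z
... | u , u∼z , inj₁ refl = u , u∼z , inj₂ [ x∼y ]⁺
... | u , u∼z , inj₂ y∼⁺u = u , u∼z , inj₂ (x∼y ∷ y∼⁺u)

module _ {A : Set} (w : A → ℚ) where

  sumOf : List A → ℚ
  sumOf L = foldr _+_ 0ℚ (map w L)

  record Partition (P Q : A → Set) (L : List A) : Set where
    field
      left right   : List A
      left⊆        : left ⊆ L
      right⊆       : right ⊆ L
      All-left     : All P left
      All-right    : All Q right
      sumOf-split  : sumOf L ≡ sumOf left + sumOf right

  partition : ∀ {P Q : A → Set} L → All (λ b → P b ⊎ Q b) L → Partition P Q L
  partition [] [] = record { left = [] ; right = [] ; left⊆ = [] ; right⊆ = []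
                           ; All-left = [] ; All-right = [] ; sumOf-split = refl }
  partition (b ∷ L) (inj₁ pb ∷ ps) = record
    { left = b ∷ left ; right = right ; left⊆ = refl ∷ left⊆ ; right⊆ = b ∷ʳ right⊆
    ; All-left = pb ∷ All-left ; All-right = All-right
    ; sumOf-split = trans (cong (λ s → w b + s) sumOf-split) (sym (+-assoc (w b) (sumOf left) (sumOf right))) }
    where open Partition (partition L ps)
  partition (b ∷ L) (inj₂ qb ∷ ps) = record
    { left = left ; right = b ∷ right ; left⊆ = b ∷ʳ left⊆ ; right⊆ = refl ∷ right⊆
    ; All-left = All-left ; All-right = qb ∷ All-right
    ; sumOf-split = trans (cong (λ s → w b + s) sumOf-split)
        (solve 3 (λ x y z → x :+ (y :+ z) := y :+ (x :+ z)) refl (w b) (sumOf left) (sumOf right)) }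
    where open Partition (partition L ps)

module _ {A : Set} {w : A → ℚ} (w-nonNeg : ∀ a → 0ℚ ≤ w a) where

  sumOf-copies≤ : ∀ {c} L → Unique L → All (_≡ c) L → sumOf w L ≤ w c
  sumOf-copies≤ {c} [] _ _ = w-nonNeg c
  sumOf-copies≤ (_ ∷ []) _ (refl ∷ []) = ≤-reflexive (+-identityʳ _)
  sumOf-copies≤ (_ ∷ _ ∷ _) ((b≢b′ ∷ _) ∷ _) (refl ∷ refl ∷ _) = ⊥-elim (b≢b′ refl)

  sumOf-cover : ∀ {P : A → A → Set} {K} → 0ℚ ≤ K →
                (∀ c L → Unique L → All (P c) L → sumOf w L ≤ K) →
                ∀ C L → Unique L → All (λ b → Any (λ c → P c b) C) L → sumOf w L ≤ ℕ→ℚ (length C) * K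
  sumOf-cover {K = K} _ _ [] [] _ _ = ≤-reflexive (sym (*-zeroˡ K))
  sumOf-cover _ _ [] (_ ∷ _) _ (() ∷ _)
  sumOf-cover {K = K} 0≤K part-bound (c ∷ C) L u covered = begin
    sumOf w L                     ≡⟨ sumOf-split ⟩
    sumOf w left + sumOf w right  ≤⟨ +-mono-≤ (part-bound c left (Unique-resp-⊆ left⊆ u) All-left)
                                       (sumOf-cover 0≤K part-bound C right (Unique-resp-⊆ right⊆ u) All-right) ⟩
    K + ℕ→ℚ (length C) * K        ≡⟨ solve 2 (λ k n → k :+ n :* k := (con 1ℚ :+ n) :* k) refl K (ℕ→ℚ (length C)) ⟩
    (1ℚ + ℕ→ℚ (length C)) * K     ≡⟨ cong (_* K) (sym (ℕ→ℚ-+ 1 (length C))) ⟩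
    ℕ→ℚ (suc (length C)) * K      ∎
    where
    open ≤-Reasoning
    open Partition (partition w L (All.map Any.toSum covered))

module DecayingBinaryForest {A : Set} (_≺_ : A → A → Set) (≺-wellFounded : WellFounded _≺_)
  (w : A → ℚ) (w-nonNeg : ∀ a → 0ℚ ≤ w a) (ε : ℚ) (0≤ε : 0ℚ ≤ ε) (ε≤¼ : ε ≤ (+ 1) / 4)
  (decay : ∀ {b a} → b ≺ a → w b ≤ ε * w a)
  (binary : ∀ a → Σ[ C ∈ List A ] (length C ℕ.≤ 2 × (∀ {b} → b ≺ a → b ∈ C)))
  where

  open ≤-Reasoning

  4ε : ℚ
  4ε = (+ 4) / 1 * ε

  0≤4ε : 0ℚ ≤ 4ε
  0≤4ε = 0≤-* (ℕ→ℚ-nonNeg 4) 0≤ε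

  4ε≤1 : 4ε ≤ 1ℚ
  4ε≤1 = *-monoˡ-≤-0≤ (ℕ→ℚ-nonNeg 4) ε≤¼

  sumOf-descendants≤′ : ∀ {a} → Acc _≺_ a → ∀ L → Unique L → All (λ b → TransClosure _≺_ b a) L →
                       sumOf w L ≤ 4ε * w a
  sumOf-descendants≤′ {a} (acc rs) L u below = begin
    sumOf w L                     ≤⟨ sumOf-cover w-nonNeg 0≤K subtree≤ C L u (All.map via-child below) ⟩
    ℕ→ℚ (length C) * K            ≤⟨ *-monoʳ-≤-0≤ 0≤K (ℕ→ℚ-mono-≤ |C|≤2) ⟩
    ℕ→ℚ 2 * ((1ℚ + 4ε) * εwa)     ≤⟨ *-monoˡ-≤-0≤ (ℕ→ℚ-nonNeg 2) (*-monoʳ-≤-0≤ 0≤εwa (+-monoʳ-≤ 1ℚ 4ε≤1)) ⟩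
    ℕ→ℚ 2 * ((1ℚ + 1ℚ) * εwa)     ≡⟨ solve 2 (λ e x → con (ℕ→ℚ 2) :* ((con 1ℚ :+ con 1ℚ) :* (e :* x))
                                        := con ((+ 4) / 1) :* e :* x) refl ε (w a) ⟩
    4ε * w a                      ∎
    where
    C = proj₁ (binary a)
    |C|≤2 = proj₁ (proj₂ (binary a))
    εwa = ε * w a
    0≤εwa : 0ℚ ≤ εwa
    0≤εwa = 0≤-* 0≤ε (w-nonNeg a)
    K = (1ℚ + 4ε) * εwa
    0≤K : 0ℚ ≤ K
    0≤K = 0≤-* (+-mono-≤ 0≤1 0≤4ε) 0≤εwa
    Subtree : A → A → Set
    Subtree c b = c ≺ a × (b ≡ c ⊎ TransClosure _≺_ b c)
    via-child : ∀ {b} → TransClosure _≺_ b a → Any (λ c → Subtree c b) C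
    via-child b≺⁺a with TransClosure-last b≺⁺a
    ... | c , c≺a , b≼c = Any.map (λ { refl → c≺a , b≼c }) (proj₂ (proj₂ (binary a)) c≺a)
    subtree≤ : ∀ c L → Unique L → All (Subtree c) L → sumOf w L ≤ K
    subtree≤ c [] _ _ = 0≤K
    subtree≤ c L@(_ ∷ _) u in-subtree@((c≺a , _) ∷ _) = begin
      sumOf w L                     ≡⟨ sumOf-split ⟩
      sumOf w left + sumOf w right  ≤⟨ +-mono-≤ (sumOf-copies≤ w-nonNeg left (Unique-resp-⊆ left⊆ u) All-left)
                                         (sumOf-descendants≤′ (rs c≺a) right (Unique-resp-⊆ right⊆ u) All-right) ⟩
      w c + 4ε * w c                ≡⟨ solve 2 (λ x f → x :+ f :* x := (con 1ℚ :+ f) :* x) refl (w c) 4ε ⟩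
      (1ℚ + 4ε) * w c               ≤⟨ *-monoˡ-≤-0≤ (+-mono-≤ 0≤1 0≤4ε) (decay c≺a) ⟩
      K                             ∎
      where open Partition (partition w L (All.map proj₂ in-subtree))

  sumOf-descendants≤ : ∀ a L → Unique L → All (λ b → TransClosure _≺_ b a) L → sumOf w L ≤ 4ε * w a
  sumOf-descendants≤ a = sumOf-descendants≤′ (≺-wellFounded a)

-- Queue potentials

length-∷ʳ : ∀ {A : Set} (xs : List A) x → length (xs ++ [ x ]) ≡ suc (length xs)
length-∷ʳ [] x = refl
length-∷ʳ (_ ∷ xs) x = cong suc (length-∷ʳ xs x)

module Queues (ε : ℚ) (0≤ε : 0ℚ ≤ ε) where

  open ≤-Reasoning

  QueueBound : ∀ {A : Set} → (A → ℚ) → ℚ → List A → Set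
  QueueBound w Φ [] = ⊤
  QueueBound w Φ (e ∷ q) = (1ℚ + ε) ^ℚ length q * w e ≤ Φ × QueueBound w Φ q

  QueueBound-cong : ∀ {A : Set} {w w′ : A → ℚ} {Φ} q → All (λ e → w e ≡ w′ e) q →
                    QueueBound w Φ q → QueueBound w′ Φ q
  QueueBound-cong [] [] tt = tt
  QueueBound-cong {Φ = Φ} (e ∷ q) (we≡ ∷ ws≡) (bound , bounds) =
    subst (λ z → (1ℚ + ε) ^ℚ length q * z ≤ Φ) we≡ bound , QueueBound-cong q ws≡ bounds

  QueueBound-snoc : ∀ {A : Set} {w : A → ℚ} {Φ W} e q → 0ℚ ≤ Φ → w e ≤ W → ε * Φ ≤ W →
                    QueueBound w Φ q → QueueBound w (Φ + W) (q ++ [ e ])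
  QueueBound-snoc {w = w} {Φ} {W} e [] 0≤Φ we≤W _ tt = ≤-trans (≤-reflexive (*-identityˡ (w e))) we≤Φ+W , tt
    where
    we≤Φ+W : w e ≤ Φ + W
    we≤Φ+W = subst (w e ≤_) (+-comm W Φ) (≤-trans we≤W (p≤p+q W 0≤Φ))
  QueueBound-snoc {w = w} {Φ} {W} e (f ∷ q) 0≤Φ we≤W εΦ≤W (bound , bounds) =
    shifted , QueueBound-snoc e q 0≤Φ we≤W εΦ≤W bounds
    where
    shifted : (1ℚ + ε) ^ℚ length (q ++ [ e ]) * w f ≤ Φ + W
    shifted = begin
      (1ℚ + ε) ^ℚ length (q ++ [ e ]) * w f   ≡⟨ cong (λ k → (1ℚ + ε) ^ℚ k * w f) (length-∷ʳ q e) ⟩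
      (1ℚ + ε) * (1ℚ + ε) ^ℚ length q * w f   ≡⟨ *-assoc (1ℚ + ε) _ _ ⟩
      (1ℚ + ε) * ((1ℚ + ε) ^ℚ length q * w f) ≤⟨ *-monoˡ-≤-0≤ (+-mono-≤ 0≤1 0≤ε) bound ⟩
      (1ℚ + ε) * Φ                            ≡⟨ solve 2 (λ e f → (con 1ℚ :+ e) :* f := f :+ e :* f) refl ε Φ ⟩
      Φ + ε * Φ                               ≤⟨ +-monoʳ-≤ Φ εΦ≤W ⟩
      Φ + W                                   ∎

  QueueBound-head : ∀ {A : Set} {w : A → ℚ} {Φ} e q → 0ℚ ≤ w e → 1ℚ ≤ ε * ε * (1ℚ + ε) ^ℚ length q →
                    QueueBound w Φ (e ∷ q) → w e ≤ ε * (ε * Φ)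
  QueueBound-head {w = w} {Φ} e q 0≤we 1≤ε²[1+ε]^q (bound , _) = begin
    w e                                      ≡⟨ sym (*-identityˡ (w e)) ⟩
    1ℚ * w e                                 ≤⟨ *-monoʳ-≤-0≤ 0≤we 1≤ε²[1+ε]^q ⟩
    ε * ε * (1ℚ + ε) ^ℚ length q * w e       ≡⟨ solve 3 (λ e a x → e :* e :* a :* x := e :* (e :* (a :* x)))
                                                 refl ε ((1ℚ + ε) ^ℚ length q) (w e) ⟩
    ε * (ε * ((1ℚ + ε) ^ℚ length q * w e))   ≤⟨ *-monoˡ-≤-0≤ 0≤ε (*-monoˡ-≤-0≤ 0≤ε bound) ⟩
    ε * (ε * Φ)                              ∎

-- Execution of Algorithm B

if-≟-same : ∀ {k} {A : Set} (x : Fin k) (a b : A) → (if does (x ≟ x) then a else b) ≡ a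
if-≟-same x a b with x ≟ x
... | yes _ = refl
... | no x≢x = ⊥-elim (x≢x refl)

if-≟-other : ∀ {k} {A : Set} {x y : Fin k} (a b : A) → y ≢ x → (if does (y ≟ x) then a else b) ≡ b
if-≟-other {x = x} {y} a b y≢x with y ≟ x
... | yes y≡x = ⊥-elim (y≢x y≡x)
... | no _ = refl

∷ʳ≢[] : ∀ {A : Set} (xs : List A) y → xs ++ [ y ] ≢ []
∷ʳ≢[] [] _ ()
∷ʳ≢[] (_ ∷ _) _ ()

data Enqueued {m : ℕ} (ε : ℚ) (i : Fin m) (q q′ : List (Fin m)) (log log′ : List (Fin m × Fin m)) : Set where
  appended : q′ ≡ q ++ [ i ] → log′ ≡ log → Enqueued ε i q q′ log log′
  evicted  : ∀ e → q ++ [ i ] ≡ e ∷ q′ → ≤βᵇ ε (length (q ++ [ i ])) ≡ false →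
             log′ ≡ (i , e) ∷ log → Enqueued ε i q q′ log log′

record Frame {n m : ℕ} (x : Fin n) (st st′ : State n m) : Set where
  field
    φ-frame  : φ st′ ≡ φ st
    w′-frame : w′ st′ ≡ w′ st
    Q-frame  : ∀ y → y ≢ x → Q st′ y ≡ Q st y

enqueue-view : ∀ {n m} ε (i : Fin m) (x : Fin n) st → let st′ = enqueue ε i x st in
               Enqueued ε i (Q st x) (Q st′ x) (evLog st) (evLog st′) × Frame x st st′
enqueue-view ε i x st with Q st x ++ [ i ] in q≡
... | q with >βᵇ ε (length q) in >β
...   | false = appended (trans (if-≟-same x q _) (sym q≡)) refl
              , record { φ-frame = refl ; w′-frame = refl ; Q-frame = λ _ → if-≟-other q _ }
...   | true with q
...     | [] = ⊥-elim (∷ʳ≢[] (Q st x) i q≡)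
...     | e ∷ q′ = evicted e (trans q≡ (cong (e ∷_) (sym (if-≟-same x q′ _))))
                     (not-injective (trans (cong (λ q → >βᵇ ε (length q)) q≡) >β)) refl
                 , record { φ-frame = refl ; w′-frame = refl ; Q-frame = λ _ → if-≟-other q′ _ }

module Execution {n m : ℕ} (ε : ℚ) (0<ε : 0ℚ < ε) (ε≤¼ : ε ≤ (+ 1) / 4)
                 (G : Vec (Edge n) m) (no-loops : ∀ i → src (lookup G i) ≢ tgt (lookup G i)) where

  open Threshold ε 0<ε ε≤¼
  open Queues ε 0≤ε

  module Step (st : State n m) (i : Fin m) where
    u v : Fin n
    u = src (lookup G i)
    v = tgt (lookup G i)

    s w′ᵢ : ℚ
    s = φ st u + φ st v
    w′ᵢ = wt (lookup G i) - s

    pushed-state : State n m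
    pushed-state = record st
      { φ = λ y → if does (y ≟ u) ∨ does (y ≟ v) then φ st y + w′ᵢ else φ st y
      ; w′ = λ y → if does (y ≟ i) then w′ᵢ else w′ st y
      ; pushed = λ y → if does (y ≟ i) then true else pushed st y
      ; S = i ∷ S st }

    pushes : Bool
    pushes = (1ℚ + ε) * s ≤ᵇ wt (lookup G i)

    step-skip : pushes ≡ false → step ε G st i ≡ st
    step-skip skip rewrite skip = refl

    step-push : pushes ≡ true → step ε G st i ≡ enqueue ε i v (enqueue ε i u pushed-state)
    step-push push rewrite push = refl

  -- rest lists the edges still to be processed; the stream is processed in index order.
  Processed : List (Fin m) → Fin m → Set
  Processed rest j = All (j Fin.<_) rest

  record Invariant (st : State n m) (rest : List (Fin m)) : Set where
    field
      φ-nonNeg          : ∀ x → 0ℚ ≤ φ st x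
      w′-nonNeg         : ∀ j → 0ℚ ≤ w′ st j
      queued-processed  : ∀ x → All (Processed rest) (Q st x)
      queue-bound       : ∀ x → QueueBound (w′ st) (φ st x) (Q st x)
      evictor-processed : ∀ {a b} → (a , b) ∈ evLog st → Processed rest a
      eviction-order    : ∀ {a b} → (a , b) ∈ evLog st → b Fin.< a
      eviction-decay    : ∀ {a b} → (a , b) ∈ evLog st → w′ st b ≤ ε * w′ st a
      evictions≤2       : ∀ a → Σ[ C ∈ List (Fin m) ] (length C ℕ.≤ 2 × (∀ {b} → (a , b) ∈ evLog st → b ∈ C))

  open Invariant

  initial-invariant : Invariant initState (allFin m)
  initial-invariant = record
    { φ-nonNeg = λ _ → ≤-refl ; w′-nonNeg = λ _ → ≤-refl ; queued-processed = λ _ → []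
    ; queue-bound = λ _ → tt ; evictor-processed = λ () ; eviction-order = λ ()
    ; eviction-decay = λ () ; evictions≤2 = λ _ → [] , ℕ.z≤n , λ () }

  skip-invariant : ∀ {st i rest} → Invariant st (i ∷ rest) → Invariant st rest
  skip-invariant inv = record
    { φ-nonNeg = φ-nonNeg inv ; w′-nonNeg = w′-nonNeg inv
    ; queued-processed = λ x → All.map All.tail (queued-processed inv x)
    ; queue-bound = queue-bound inv
    ; evictor-processed = λ ab∈ → All.tail (evictor-processed inv ab∈)
    ; eviction-order = eviction-order inv ; eviction-decay = eviction-decay inv
    ; evictions≤2 = evictions≤2 inv }

  module Push {st : State n m} {i : Fin m} {rest : List (Fin m)} (inv : Invariant st (i ∷ rest))
              (i-first : Processed rest i) (push : Step.pushes st i ≡ true) where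

    open Step st i

    A B C : State n m
    A = pushed-state
    B = enqueue ε i u A
    C = enqueue ε i v B

    εs≤w′ᵢ : ε * s ≤ w′ᵢ
    εs≤w′ᵢ = begin
      ε * s               ≡⟨ solve 2 (λ e s → e :* s := (con 1ℚ :+ e) :* s :- s) refl ε s ⟩
      (1ℚ + ε) * s - s    ≤⟨ +-monoˡ-≤ (- s) [1+ε]s≤w ⟩
      wt (lookup G i) - s ∎
      where
      open ≤-Reasoning
      [1+ε]s≤w : (1ℚ + ε) * s ≤ wt (lookup G i)
      [1+ε]s≤w = ≤ᵇ⇒≤ (subst T (sym push) tt)

    0≤s : 0ℚ ≤ s
    0≤s = +-mono-≤ (φ-nonNeg inv u) (φ-nonNeg inv v)

    0≤w′ᵢ : 0ℚ ≤ w′ᵢ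
    0≤w′ᵢ = ≤-trans (0≤-* 0≤ε 0≤s) εs≤w′ᵢ

    εφᵤ≤w′ᵢ : ε * φ st u ≤ w′ᵢ
    εφᵤ≤w′ᵢ = ≤-trans (*-monoˡ-≤-0≤ 0≤ε (p≤p+q (φ st u) (φ-nonNeg inv v))) εs≤w′ᵢ

    εφᵥ≤w′ᵢ : ε * φ st v ≤ w′ᵢ
    εφᵥ≤w′ᵢ = ≤-trans (*-monoˡ-≤-0≤ 0≤ε (subst (φ st v ≤_) (+-comm (φ st v) (φ st u))
                                            (p≤p+q (φ st v) (φ-nonNeg inv u)))) εs≤w′ᵢ

    earlier⇒≢ : ∀ {j} → Processed (i ∷ rest) j → j ≢ i
    earlier⇒≢ (j<i ∷ _) = Fin.<⇒≢ j<i

    w′A-i : w′ A i ≡ w′ᵢ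
    w′A-i = if-≟-same i w′ᵢ (w′ st i)

    w′A-other : ∀ {j} → j ≢ i → w′ A j ≡ w′ st j
    w′A-other = if-≟-other w′ᵢ _

    Evictee : Fin m → Set
    Evictee b = b Fin.< i × w′ A b ≤ ε * w′ᵢ

    record Outcome (Φ : ℚ) (q′ : List (Fin m)) (log log′ : List (Fin m × Fin m)) : Set where
      field
        bound       : QueueBound (w′ A) (Φ + w′ᵢ) q′
        processed   : All (Processed rest) q′
        evictees    : List (Fin m)
        evictees≤1  : length evictees ℕ.≤ 1
        log≡        : log′ ≡ map (i ,_) evictees ++ log
        evictees-ok : All Evictee evictees

    bound-after-append : ∀ {Φ} q → 0ℚ ≤ Φ → ε * Φ ≤ w′ᵢ → QueueBound (w′ st) Φ q →
                         All (Processed (i ∷ rest)) q → QueueBound (w′ A) (Φ + w′ᵢ) (q ++ [ i ])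
    bound-after-append q 0≤Φ εΦ≤w′ᵢ bound earlier =
      QueueBound-snoc i q 0≤Φ (≤-reflexive w′A-i) εΦ≤w′ᵢ
        (QueueBound-cong q (All.map (λ p → sym (w′A-other (earlier⇒≢ p))) earlier) bound)

    processed-after-append : ∀ {q} → All (Processed (i ∷ rest)) q → All (Processed rest) (q ++ [ i ])
    processed-after-append earlier = All.++⁺ (All.map All.tail earlier) (i-first ∷ [])

    enqueue-outcome : ∀ {Φ q q′ log log′} → 0ℚ ≤ Φ → ε * Φ ≤ w′ᵢ → QueueBound (w′ st) Φ q →
                      All (Processed (i ∷ rest)) q → Enqueued ε i q q′ log log′ → Outcome Φ q′ log log′
    enqueue-outcome {q = q} 0≤Φ εΦ≤w′ᵢ bound earlier (appended refl refl) = record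
      { bound = bound-after-append q 0≤Φ εΦ≤w′ᵢ bound earlier
      ; processed = processed-after-append earlier
      ; evictees = [] ; evictees≤1 = ℕ.z≤n ; log≡ = refl ; evictees-ok = [] }
    enqueue-outcome {q = []} _ _ _ _ (evicted _ refl 1>β _) with () ← trans (sym 1≤β) 1>β
    enqueue-outcome {Φ} {q = e ∷ q} 0≤Φ εΦ≤w′ᵢ bound earlier@((e<i ∷ _) ∷ _) (evicted e refl 2+q>β refl) = record
      { bound = proj₂ (bound-after-append (e ∷ q) 0≤Φ εΦ≤w′ᵢ bound earlier)
      ; processed = All.tail (processed-after-append earlier)
      ; evictees = [ e ] ; evictees≤1 = ℕ.s≤s ℕ.z≤n ; log≡ = refl
      ; evictees-ok = (e<i , evictee-bound) ∷ [] }
      where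
      open ≤-Reasoning
      1≤ε²[1+ε]^q : 1ℚ ≤ ε * ε * (1ℚ + ε) ^ℚ length q
      1≤ε²[1+ε]^q = 2+l>β⇒1≤ε²[1+ε]^l (length q)
                      (subst (λ k → ≤βᵇ ε (suc k) ≡ false) (length-∷ʳ q i) 2+q>β)
      evictee-bound : w′ A e ≤ ε * w′ᵢ
      evictee-bound = begin
        w′ A e       ≡⟨ w′A-other (earlier⇒≢ (All.head earlier)) ⟩
        w′ st e      ≤⟨ QueueBound-head e q (w′-nonNeg inv e) 1≤ε²[1+ε]^q bound ⟩
        ε * (ε * Φ)  ≤⟨ *-monoˡ-≤-0≤ 0≤ε εΦ≤w′ᵢ ⟩
        ε * w′ᵢ      ∎

    u≢v : u ≢ v
    u≢v = no-loops i

    -- Opaque, since unfolding enqueue makes Agda evaluate the rational threshold test symbolically.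
    opaque
      frame-B : Frame u A B
      frame-B = proj₂ (enqueue-view ε i u A)

      frame-C : Frame v B C
      frame-C = proj₂ (enqueue-view ε i v B)

      outcome-u : Outcome (φ st u) (Q B u) (evLog st) (evLog B)
      outcome-u = enqueue-outcome (φ-nonNeg inv u) εφᵤ≤w′ᵢ (queue-bound inv u) (queued-processed inv u)
                    (proj₁ (enqueue-view ε i u A))

      outcome-v : Outcome (φ st v) (Q C v) (evLog B) (evLog C)
      outcome-v = enqueue-outcome (φ-nonNeg inv v) εφᵥ≤w′ᵢ (queue-bound inv v) (queued-processed inv v)
                    (subst (λ q → Enqueued ε i q (Q C v) (evLog B) (evLog C))
                           (Frame.Q-frame frame-B v (λ v≡u → u≢v (sym v≡u)))
                           (proj₁ (enqueue-view ε i v B)))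

    open Frame
    open Outcome

    φC≡φA : ∀ x → φ C x ≡ φ A x
    φC≡φA = cong-app (trans (φ-frame frame-C) (φ-frame frame-B))

    w′C≡w′A : ∀ j → w′ C j ≡ w′ A j
    w′C≡w′A = cong-app (trans (w′-frame frame-C) (w′-frame frame-B))

    data Vertex (x : Fin n) : Set where
      at-u      : x ≡ u → Vertex x
      at-v      : x ≡ v → Vertex x
      elsewhere : x ≢ u → x ≢ v → Vertex x

    vertex : ∀ x → Vertex x
    vertex x with x ≟ u | x ≟ v
    ... | yes x≡u | _       = at-u x≡u
    ... | no _    | yes x≡v = at-v x≡v
    ... | no x≢u  | no x≢v  = elsewhere x≢u x≢v

    φA-endpoint : ∀ {x} → x ≡ u ⊎ x ≡ v → φ A x ≡ φ st x + w′ᵢ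
    φA-endpoint {x} x∈uv with x ≟ u | x ≟ v | x∈uv
    ... | yes _ | _     | _       = refl
    ... | no _  | yes _ | _       = refl
    ... | no x≢u | no _ | inj₁ x≡u = ⊥-elim (x≢u x≡u)
    ... | no _ | no x≢v | inj₂ x≡v = ⊥-elim (x≢v x≡v)

    φA-elsewhere : ∀ {x} → x ≢ u → x ≢ v → φ A x ≡ φ st x
    φA-elsewhere {x} x≢u x≢v with x ≟ u | x ≟ v
    ... | yes x≡u | _       = ⊥-elim (x≢u x≡u)
    ... | no _    | yes x≡v = ⊥-elim (x≢v x≡v)
    ... | no _    | no _    = refl

    QCu≡QBu : Q C u ≡ Q B u
    QCu≡QBu = Q-frame frame-C u u≢v

    QC-elsewhere : ∀ {x} → x ≢ u → x ≢ v → Q C x ≡ Q st x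
    QC-elsewhere {x} x≢u x≢v = trans (Q-frame frame-C x x≢v) (Q-frame frame-B x x≢u)

    new-evictees : List (Fin m)
    new-evictees = evictees outcome-v ++ evictees outcome-u

    evLogC≡ : evLog C ≡ map (i ,_) new-evictees ++ evLog st
    evLogC≡ = begin
      evLog C                                       ≡⟨ log≡ outcome-v ⟩
      map (i ,_) Nᵥ ++ evLog B                      ≡⟨ cong (map (i ,_) Nᵥ ++_) (log≡ outcome-u) ⟩
      map (i ,_) Nᵥ ++ map (i ,_) Nᵤ ++ evLog st    ≡⟨ sym (List.++-assoc (map (i ,_) Nᵥ) _ _) ⟩
      (map (i ,_) Nᵥ ++ map (i ,_) Nᵤ) ++ evLog st  ≡⟨ cong (_++ evLog st) (sym (List.map-++ (i ,_) Nᵥ Nᵤ)) ⟩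
      map (i ,_) (Nᵥ ++ Nᵤ) ++ evLog st             ∎
      where
      open ≡-Reasoning
      Nᵤ Nᵥ : List (Fin m)
      Nᵤ = evictees outcome-u
      Nᵥ = evictees outcome-v

    new-evictees-ok : All Evictee new-evictees
    new-evictees-ok = All.++⁺ (evictees-ok outcome-v) (evictees-ok outcome-u)

    |new-evictees|≤2 : length new-evictees ℕ.≤ 2
    |new-evictees|≤2 = ℕ.≤-trans (ℕ.≤-reflexive (List.length-++ (evictees outcome-v)))
                                 (ℕ.+-mono-≤ (evictees≤1 outcome-v) (evictees≤1 outcome-u))

    log-cases : ∀ {a b} → (a , b) ∈ evLog C → (a ≡ i × b ∈ new-evictees) ⊎ (a , b) ∈ evLog st
    log-cases ab∈ with ∈-++⁻ (map (i ,_) new-evictees) (subst ((_ , _) ∈_) evLogC≡ ab∈)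
    ... | inj₁ ab∈new with ∈-map⁻ (i ,_) ab∈new
    ...   | b , b∈ , refl = inj₁ (refl , b∈)
    log-cases ab∈ | inj₂ ab∈old = inj₂ ab∈old

    old-evictor≢i : ∀ {a b} → (a , b) ∈ evLog st → a ≢ i
    old-evictor≢i ab∈ = earlier⇒≢ (evictor-processed inv ab∈)

    old-evictee≢i : ∀ {a b} → (a , b) ∈ evLog st → b ≢ i
    old-evictee≢i ab∈ = Fin.<⇒≢ (Fin.<-trans (eviction-order inv ab∈) (All.head (evictor-processed inv ab∈)))


    φ-nonNeg′ : ∀ x → 0ℚ ≤ φ C x
    φ-nonNeg′ x rewrite φC≡φA x with vertex x
    ... | at-u x≡u = subst (0ℚ ≤_) (sym (φA-endpoint (inj₁ x≡u))) (+-mono-≤ (φ-nonNeg inv x) 0≤w′ᵢ)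
    ... | at-v x≡v = subst (0ℚ ≤_) (sym (φA-endpoint (inj₂ x≡v))) (+-mono-≤ (φ-nonNeg inv x) 0≤w′ᵢ)
    ... | elsewhere x≢u x≢v = subst (0ℚ ≤_) (sym (φA-elsewhere x≢u x≢v)) (φ-nonNeg inv x)

    w′-nonNeg′ : ∀ j → 0ℚ ≤ w′ C j
    w′-nonNeg′ j rewrite w′C≡w′A j with j Fin.≟ i
    ... | yes refl = 0≤w′ᵢ
    ... | no _ = w′-nonNeg inv j

    queued-processed′ : ∀ x → All (Processed rest) (Q C x)
    queued-processed′ x with vertex x
    ... | at-u refl = subst (All (Processed rest)) (sym QCu≡QBu) (processed outcome-u)
    ... | at-v refl = processed outcome-v
    ... | elsewhere x≢u x≢v = subst (All (Processed rest)) (sym (QC-elsewhere x≢u x≢v))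
                                (All.map All.tail (queued-processed inv x))

    queue-bound′ : ∀ x → QueueBound (w′ C) (φ C x) (Q C x)
    queue-bound′ x rewrite trans (w′-frame frame-C) (w′-frame frame-B) | φC≡φA x with vertex x
    ... | at-u refl rewrite QCu≡QBu | φA-endpoint (inj₁ refl) = bound outcome-u
    ... | at-v refl rewrite φA-endpoint (inj₂ refl) = bound outcome-v
    ... | elsewhere x≢u x≢v rewrite QC-elsewhere x≢u x≢v | φA-elsewhere x≢u x≢v =
      QueueBound-cong (Q st x) (All.map (λ p → sym (w′A-other (earlier⇒≢ p))) (queued-processed inv x))
        (queue-bound inv x)

    evictor-processed′ : ∀ {a b} → (a , b) ∈ evLog C → Processed rest a
    evictor-processed′ ab∈ with log-cases ab∈
    ... | inj₁ (refl , _) = i-first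
    ... | inj₂ ab∈old = All.tail (evictor-processed inv ab∈old)

    eviction-order′ : ∀ {a b} → (a , b) ∈ evLog C → b Fin.< a
    eviction-order′ ab∈ with log-cases ab∈
    ... | inj₁ (refl , b∈) = proj₁ (All.lookup new-evictees-ok b∈)
    ... | inj₂ ab∈old = eviction-order inv ab∈old

    eviction-decay′ : ∀ {a b} → (a , b) ∈ evLog C → w′ C b ≤ ε * w′ C a
    eviction-decay′ {a} {b} ab∈ rewrite w′C≡w′A a | w′C≡w′A b with log-cases ab∈
    ... | inj₁ (refl , b∈) rewrite w′A-i = proj₂ (All.lookup new-evictees-ok b∈)
    ... | inj₂ ab∈old rewrite w′A-other (old-evictor≢i ab∈old) | w′A-other (old-evictee≢i ab∈old) =
      eviction-decay inv ab∈old

    evictions≤2′ : ∀ a → Σ[ D ∈ List (Fin m) ] (length D ℕ.≤ 2 × (∀ {b} → (a , b) ∈ evLog C → b ∈ D))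
    evictions≤2′ a with a Fin.≟ i | evictions≤2 inv a
    ... | yes refl | _ = new-evictees , |new-evictees|≤2 , evicted-by-i
      where
      evicted-by-i : ∀ {b} → (i , b) ∈ evLog C → b ∈ new-evictees
      evicted-by-i ab∈ with log-cases ab∈
      ... | inj₁ (_ , b∈) = b∈
      ... | inj₂ ab∈old = ⊥-elim (old-evictor≢i ab∈old refl)
    ... | no a≢i | D , |D|≤2 , evicted-by-a = D , |D|≤2 , evicted-by-a′
      where
      evicted-by-a′ : ∀ {b} → (a , b) ∈ evLog C → b ∈ D
      evicted-by-a′ ab∈ with log-cases ab∈
      ... | inj₁ (a≡i , _) = ⊥-elim (a≢i a≡i)
      ... | inj₂ ab∈old = evicted-by-a ab∈old

    push-invariant : Invariant C rest
    push-invariant = record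
      { φ-nonNeg = φ-nonNeg′ ; w′-nonNeg = w′-nonNeg′ ; queued-processed = queued-processed′
      ; queue-bound = queue-bound′ ; evictor-processed = evictor-processed′
      ; eviction-order = eviction-order′ ; eviction-decay = eviction-decay′ ; evictions≤2 = evictions≤2′ }

  step-invariant : ∀ {st i rest} → Invariant st (i ∷ rest) → Processed rest i → Invariant (step ε G st i) rest
  step-invariant {st} {i} {rest} inv i-first = by-test (Step.pushes st i) refl
    where
    by-test : ∀ b → Step.pushes st i ≡ b → Invariant (step ε G st i) rest
    by-test true pushes = subst (λ st′ → Invariant st′ rest) (sym (Step.step-push st i pushes))
                            (Push.push-invariant inv i-first pushes)
    by-test false skips = subst (λ st′ → Invariant st′ rest) (sym (Step.step-skip st i skips)) (skip-invariant inv)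

  fold-invariant : ∀ {st} rest → AllPairs Fin._<_ rest → Invariant st rest →
                   Invariant (foldl (step ε G) st rest) []
  fold-invariant [] [] inv = inv
  fold-invariant (i ∷ rest) (i-first ∷ sorted) inv = fold-invariant rest sorted (step-invariant inv i-first)

  run-invariant : Invariant (run ε G) []
  run-invariant = fold-invariant (allFin m) (AllPairs.tabulate⁺-< (λ i<j → i<j)) initial-invariant

lemma8 : {n m : ℕ} (ε : ℚ) → 0ℚ < ε → ε ≤ (+ 1) / 4 →
         (G : Vec (Edge n) m) → SimpleStream G →
         (e : Fin m) (L : List (Fin m)) → Unique L → All (InD ε G e) L →
         foldr _+_ 0ℚ (map (w′ₑ ε G) L) ≤ ((+ 4) / 1 * ε) * w′ₑ ε G e
lemma8 ε 0<ε ε≤¼ G (no-loops , _) e L unique in-𝒟 =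
  sumOf-descendants≤ e L unique (All.map proj₂ in-𝒟)
  where
  open Execution ε 0<ε ε≤¼ G no-loops
  open Invariant run-invariant
  evictedBy-wellFounded : WellFounded (EvictedBy ε G)
  evictedBy-wellFounded = Subrelation.wellFounded eviction-order Fin.<-wellFounded
  open DecayingBinaryForest (EvictedBy ε G) evictedBy-wellFounded (w′ₑ ε G) w′-nonNeg
                            ε (<⇒≤ 0<ε) ε≤¼ eviction-decay evictions≤2
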